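{- Let $N,m,k\in\mathbb{N}$ with $\gcd(Nk,m)=1$. If $s\in\mathcal{L}_{N,m,k}$, then $-s\in\mathcal{L}_{N,m,k}$.
   Context: $\mathcal{H}_{N,m}:=\{(x,y)\in(\mathbb{Z}/m\mathbb{Z})^2: xy\equiv N \bmod m\}$ and $\mathcal{L}_{N,m,k}:=\{kx+y\bmod m:(x,y)\in\mathcal{H}_{N,m}\}$. -}

module Defs where

open import Data.Nat using (ℕ)
open import Data.Integer using (ℤ; +_; _+_; _*_; _-_)
open import Data.Integer.Divisibility using (_∣_)
open import Data.Product using (Σ; _×_)

-- Congruence modulo m on ℤ:  a ≡ b (mod m)  iff  m ∣ (a - b).
-- Elements of ℤ/mℤ are represented by integers up to this congruence
-- (for m = 0 this is equality, i.e. ℤ/0ℤ = ℤ).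
_≡_[mod_] : ℤ → ℤ → ℕ → Set
a ≡ b [mod m ] = (+ m) ∣ (a - b)

InH : ℕ → ℕ → ℤ → ℤ → Set
InH N m x y = (x * y) ≡ (+ N) [mod m ]

InL : ℕ → ℕ → ℕ → ℤ → Set
InL N m k s = Σ ℤ λ x → Σ ℤ λ y → InH N m x y × ((+ k) * x + y) ≡ s [mod m ]

{-# OPTIONS --safe #-}
-- The involution (x , y) ↦ (- x , - y) maps H_{N,m} to itself, since (- x)(- y) = x y,
-- and sends the value k x + y to its negative.
module Submission where

open import Defs
open import Data.Nat using (ℕ; _*_)
open import Data.Nat.GCD using (gcd)
open import Data.Integer using (ℤ; -_)
open import Relation.Binary.PropositionalEquality using (_≡_; sym; cong; subst; module ≡-Reasoning)
import Data.Integer as ℤ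
import Data.Integer.Properties as ℤ
import Data.Nat.Divisibility as ℕ
open import Data.Integer.Divisibility using (_∣_)
open import Data.Product using (_,_)
open ≡-Reasoning

∣-neg : ∀ {d} i → d ∣ i → d ∣ - i
∣-neg {d} i = subst (ℤ.∣_∣ d ℕ.∣_) (sym (ℤ.∣-i∣≡∣i∣ i))

≡-mod-neg : ∀ {m} a b → a ≡ b [mod m ] → (- a) ≡ (- b) [mod m ]
≡-mod-neg {m} a b a≡b = subst (ℤ.+ m ∣_) (ℤ.neg-distrib-+ a (- b)) (∣-neg {ℤ.+ m} (a ℤ.- b) a≡b)

≡-mod-substˡ : ∀ {m a a′ b} → a ≡ a′ → a ≡ b [mod m ] → a′ ≡ b [mod m ]
≡-mod-substˡ {m} {b = b} a≡a′ = subst (λ t → t ≡ b [mod m ]) a≡a′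

neg*neg : ∀ x y → (- x) ℤ.* (- y) ≡ x ℤ.* y
neg*neg x y = begin
  (- x) ℤ.* (- y)  ≡⟨ ℤ.neg-distribˡ-* x (- y) ⟨
  - (x ℤ.* - y)    ≡⟨ cong -_ (ℤ.neg-distribʳ-* x y) ⟨
  - - (x ℤ.* y)    ≡⟨ ℤ.neg-involutive (x ℤ.* y) ⟩
  x ℤ.* y          ∎

linear-neg : ∀ k x y → k ℤ.* (- x) ℤ.+ (- y) ≡ - (k ℤ.* x ℤ.+ y)
linear-neg k x y = begin
  k ℤ.* (- x) ℤ.+ (- y)    ≡⟨ cong (ℤ._+ (- y)) (ℤ.neg-distribʳ-* k x) ⟨
  - (k ℤ.* x) ℤ.+ (- y)    ≡⟨ ℤ.neg-distrib-+ (k ℤ.* x) y ⟨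
  - (k ℤ.* x ℤ.+ y)        ∎

InH-neg : ∀ {N m} x y → InH N m x y → InH N m (- x) (- y)
InH-neg x y = ≡-mod-substˡ (sym (neg*neg x y))

InL-neg : ∀ N m k s → InL N m k s → InL N m k (- s)
InL-neg N m k s (x , y , xy≡N , kx+y≡s) =
  - x , - y , InH-neg x y xy≡N ,
  ≡-mod-substˡ (sym (linear-neg (ℤ.+ k) x y)) (≡-mod-neg (ℤ.+ k ℤ.* x ℤ.+ y) s kx+y≡s)

lemma3p3 : (N m k : ℕ) → gcd (N * k) m ≡ 1 → (s : ℤ) → InL N m k s → InL N m k (- s)
lemma3p3 N m k _ = InL-neg N m k
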